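{- There do not exist regular clique assembly graphs $G_1$ and $G_2$ such that the Cartesian product $G_1\square G_2$ is a strongly regular graph with parameters $(99,14,1,2)$ (Conway's 99-graph). That is, if Conway's 99-graph exists, it cannot be constructed as the Cartesian product of two regular clique assembly graphs.
   Context: A strongly regular graph with parameters $(n,d,\lambda,\mu)$ is a graph on $n$ vertices, regular of degree $d$, in which every pair of adjacent vertices has exactly $\lambda$ common neighbors and every pair of distinct non-adjacent vertices has exactly $\mu$ common neighbors. A regular clique assembly $RCA(n,d,k)$ is a graph on $n$ vertices, regular of degree $d$, with clique number $k=\omega(G)\geq 2$, such that every maximal clique is a maximum clique and every edge lies in exactly one maximum clique. The Cartesian product $G_1\square G_2$ has vertex set $V(G_1)\times V(G_2)$, with $(u,u')\sim(v,v')$ iff either $u=v$ and $u'\sim v'$ in $G_2$, or $u\sim v$ in $G_1$ and $u'=v'$. -}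

module Defs where

open import Data.Nat using (ℕ; _≤_)
open import Data.Bool using (Bool; true; false; _∧_; _∨_)
open import Data.Fin using (Fin; remQuot; _≟_)
open import Data.Fin.Subset using (Subset; ∣_∣; _∈_; _∉_; _⊆_; _∩_)
open import Data.Vec using (tabulate)
open import Data.Product using (Σ; ∃; _×_; _,_; proj₁; proj₂)
open import Relation.Nullary using (¬_)
open import Relation.Nullary.Decidable using (⌊_⌋)
open import Relation.Binary.PropositionalEquality using (_≡_; _≢_)

Graph : ℕ → Set
Graph n = Fin n → Fin n → Bool

IsSimple : ∀ {n} → Graph n → Set
IsSimple {n} G = (∀ u v → G u v ≡ G v u) × (∀ u → G u u ≡ false)

Adjacent : ∀ {n} → Graph n → Fin n → Fin n → Set
Adjacent G u v = G u v ≡ true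

N : ∀ {n} → Graph n → Fin n → Subset n
N G v = tabulate (G v)

degree : ∀ {n} → Graph n → Fin n → ℕ
degree G v = ∣ N G v ∣

common : ∀ {n} → Graph n → Fin n → Fin n → ℕ
common G u v = ∣ N G u ∩ N G v ∣

IsRegular : ∀ {n} → Graph n → ℕ → Set
IsRegular G d = ∀ v → degree G v ≡ d

IsSRG : ∀ {n} → Graph n → ℕ → ℕ → ℕ → ℕ → Set
IsSRG {n} G v d l m =
  IsSimple G × (n ≡ v) × IsRegular G d
  × (∀ x y → Adjacent G x y → common G x y ≡ l)
  × (∀ x y → x ≢ y → ¬ Adjacent G x y → common G x y ≡ m)

IsClique : ∀ {n} → Graph n → Subset n → Set
IsClique G S = ∀ u v → u ∈ S → v ∈ S → u ≢ v → Adjacent G u v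

CliqueNumber : ∀ {n} → Graph n → ℕ → Set
CliqueNumber G k =
  (Σ _ λ S → IsClique G S × ∣ S ∣ ≡ k) × (∀ S → IsClique G S → ∣ S ∣ ≤ k)

IsMaximalClique : ∀ {n} → Graph n → Subset n → Set
IsMaximalClique G S = IsClique G S × (∀ T → IsClique G T → S ⊆ T → T ≡ S)

IsMaximumClique : ∀ {n} → Graph n → ℕ → Subset n → Set
IsMaximumClique G k S = IsClique G S × ∣ S ∣ ≡ k

IsRCA : ∀ {n} → Graph n → ℕ → ℕ → ℕ → Set
IsRCA {n} G v d k =
  IsSimple G × (n ≡ v) × IsRegular G d × CliqueNumber G k × (2 ≤ k)
  × (∀ S → IsMaximalClique G S → IsMaximumClique G k S)
  × (∀ x y → Adjacent G x y →
       Σ _ λ S → (IsMaximumClique G k S × x ∈ S × y ∈ S)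
         × (∀ T → IsMaximumClique G k T → x ∈ T → y ∈ T → T ≡ S))

-- Cartesian product G₁ □ G₂, with vertex set Fin (m * n) ≅ Fin m × Fin n
-- via Data.Fin.remQuot (inverse of Data.Fin.combine).
_□_ : ∀ {m n} → Graph m → Graph n → Graph (m Data.Nat.* n)
_□_ {m} {n} G₁ G₂ x y with remQuot {m} n x | remQuot {m} n y
... | (u , u′) | (v , v′) = (⌊ u ≟ v ⌋ ∧ G₂ u′ v′) ∨ (G₁ u v ∧ ⌊ u′ ≟ v′ ⌋)

{-# OPTIONS --safe #-}
-- Two vertices (u , u′) and (v , v′) of G₁ □ G₂ with u ≢ v and u′ ≢ v′ are non-adjacent, and
-- their only possible common neighbours are (u , v′) and (v , u′), each of which requires both
-- u ∼ v and u′ ∼ v′.  So μ > 0 forces both factors to be complete as soon as each has two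
-- vertices, which a regular clique assembly has.  Since n₁ n₂ = 99, one complete factor has at
-- least four vertices; a K₄ in one of its fibres gives an edge with two common neighbours,
-- contradicting λ = 1.
module Submission where

open import Defs
open import Data.Nat using (ℕ; suc; _≤_; _<_; z≤n; s≤s; _*_; _≤?_)
open import Data.Nat.Properties using (≤-trans; ≤-reflexive; *-mono-≤; ≰⇒>)
open import Data.Bool using (Bool; T; _∧_; _∨_)
open import Data.Bool.Properties using (T-≡; T-∧; T-∨)
open import Data.Fin using (Fin; zero; suc; #_; combine; inject≤; _≟_)
open import Data.Fin.Properties using (remQuot-combine; combine-surjective; combine-injectiveˡ; inject≤-injective)
open import Data.Fin.Subset using (Subset; ∣_∣; _∈_; _∩_; Nonempty)
open import Data.Fin.Subset.Properties
  using (nonempty?; Empty-unique; ∣⊥∣≡0; ∣p∣≤n; x∈p∩q⁺; x∈p∩q⁻; x∈p∧x≢y⇒x∈p-y; x∈p⇒∣p-x∣<∣p∣)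
open import Data.Vec using (tabulate)
open import Data.Vec.Properties using ([]=⇒lookup; lookup⇒[]=; lookup∘tabulate)
open import Data.Product using (∃₂; _×_; _,_; proj₁; proj₂)
open import Data.Sum using (_⊎_; inj₁; inj₂)
open import Function using (_∘_; _⇔_; mk⇔; Equivalence)
open import Relation.Nullary using (¬_; yes; no; contradiction)
open import Relation.Nullary.Decidable using (⌊_⌋; toWitness; fromWitness; from-yes; from-no)
open import Relation.Binary.PropositionalEquality using (_≡_; _≢_; refl; sym; trans; cong; cong₂; subst)

open Equivalence using (to; from)

private variable
  n n₁ n₂ m : ℕ

x∈p∧y∈p∧x≢y⇒2≤∣p∣ : {p : Subset n} {x y : Fin n} → x ∈ p → y ∈ p → x ≢ y → 2 ≤ ∣ p ∣
x∈p∧y∈p∧x≢y⇒2≤∣p∣ x∈p y∈p x≢y =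
  ≤-trans (s≤s (≤-trans (s≤s z≤n) (x∈p⇒∣p-x∣<∣p∣ (x∈p∧x≢y⇒x∈p-y y∈p (x≢y ∘ sym)))))
          (x∈p⇒∣p-x∣<∣p∣ x∈p)

∣p∣≡suc⇒Nonempty : {p : Subset n} → ∣ p ∣ ≡ suc m → Nonempty p
∣p∣≡suc⇒Nonempty {n} {p = p} ∣p∣≡suc with nonempty? p
... | yes nonempty = nonempty
... | no empty with () ← trans (sym (∣⊥∣≡0 n)) (trans (cong ∣_∣ (sym (Empty-unique empty))) ∣p∣≡suc)

two-distinct : 2 ≤ n → ∃₂ λ (a b : Fin n) → a ≢ b
two-distinct (s≤s (s≤s _)) = zero , suc zero , λ ()

9<m*n⇒4≤m⊎4≤n : 9 < m * n → 4 ≤ m ⊎ 4 ≤ n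
9<m*n⇒4≤m⊎4≤n {m} {n} 9<mn with 4 ≤? m | 4 ≤? n
... | yes 4≤m | _       = inj₁ 4≤m
... | no _    | yes 4≤n = inj₂ 4≤n
... | no 4≰m  | no 4≰n  with s≤s m≤3 ← ≰⇒> 4≰m | s≤s n≤3 ← ≰⇒> 4≰n
  = contradiction (≤-trans 9<mn (*-mono-≤ m≤3 n≤3)) (from-no (10 ≤? 9))

module _ {G : Graph n} where

  Adjacent-sym : IsSimple G → {u v : Fin n} → Adjacent G u v → Adjacent G v u
  Adjacent-sym (symmetric , _) {u} {v} u∼v = trans (symmetric v u) u∼v

  Adjacent⇒≢ : IsSimple G → {u v : Fin n} → Adjacent G u v → u ≢ v
  Adjacent⇒≢ (_ , loopless) {u} u∼u refl with () ← trans (sym u∼u) (loopless u)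

  ∈N⇔Adjacent : {x z : Fin n} → z ∈ N G x ⇔ Adjacent G x z
  ∈N⇔Adjacent {x} {z} = mk⇔
    (λ z∈N → trans (sym (lookup∘tabulate (G x) z)) ([]=⇒lookup z∈N))
    (λ x∼z → lookup⇒[]= z (tabulate (G x)) (trans (lookup∘tabulate (G x) z) x∼z))

  common-neighbour⁻ : {x y z : Fin n} → z ∈ N G x ∩ N G y → Adjacent G x z × Adjacent G y z
  common-neighbour⁻ {x} {y} z∈ with z∈Nx , z∈Ny ← x∈p∩q⁻ (N G x) (N G y) z∈ =
    ∈N⇔Adjacent .to z∈Nx , ∈N⇔Adjacent .to z∈Ny

  common-neighbour⁺ : {x y z : Fin n} → Adjacent G x z → Adjacent G y z → z ∈ N G x ∩ N G y
  common-neighbour⁺ x∼z y∼z = x∈p∩q⁺ (∈N⇔Adjacent .from x∼z , ∈N⇔Adjacent .from y∼z)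

IsComplete : Graph n → Set
IsComplete {n} G = (u v : Fin n) → u ≢ v → Adjacent G u v

IsK₄ : Graph n → (Fin 4 → Fin n) → Set
IsK₄ G f = (i j : Fin 4) → i ≢ j → Adjacent G (f i) (f j)

complete⇒K₄ : {G : Graph n} → IsComplete G → (4≤n : 4 ≤ n) → IsK₄ G (λ i → inject≤ i 4≤n)
complete⇒K₄ complete 4≤n i j i≢j = complete _ _ (i≢j ∘ inject≤-injective 4≤n 4≤n i j)

λ≤1⇒¬K₄ : {G : Graph n} → IsSimple G → (∀ x y → Adjacent G x y → common G x y ≤ 1) →
          {f : Fin 4 → Fin n} → ¬ IsK₄ G f
λ≤1⇒¬K₄ {G = G} simple λ≤1 K₄ with s≤s () ←
  ≤-trans (x∈p∧y∈p∧x≢y⇒2≤∣p∣ (common-neighbour⁺ {G = G} (K₄ (# 0) (# 2) λ ()) (K₄ (# 1) (# 2) λ ()))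
                             (common-neighbour⁺ {G = G} (K₄ (# 0) (# 3) λ ()) (K₄ (# 1) (# 3) λ ()))
                             (Adjacent⇒≢ simple (K₄ (# 2) (# 3) λ ())))
          (λ≤1 _ _ (K₄ (# 0) (# 1) λ ()))

IsRCA⇒2≤n : {G : Graph n} {v d k : ℕ} → IsRCA G v d k → 2 ≤ n
IsRCA⇒2≤n (_ , _ , _ , ((S , _ , ∣S∣≡k) , _) , 2≤k , _) = ≤-trans 2≤k (subst (_≤ _) ∣S∣≡k (∣p∣≤n S))

module _ {G₁ : Graph n₁} {G₂ : Graph n₂} where

  □-combine : ∀ u u′ v v′ →
    (G₁ □ G₂) (combine u u′) (combine v v′) ≡ (⌊ u ≟ v ⌋ ∧ G₂ u′ v′) ∨ (G₁ u v ∧ ⌊ u′ ≟ v′ ⌋)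
  □-combine u u′ v v′ = cong₂ adjacency (remQuot-combine u u′) (remQuot-combine v v′)
    where
    adjacency : Fin n₁ × Fin n₂ → Fin n₁ × Fin n₂ → Bool
    adjacency (u , u′) (v , v′) = (⌊ u ≟ v ⌋ ∧ G₂ u′ v′) ∨ (G₁ u v ∧ ⌊ u′ ≟ v′ ⌋)

  □-adjacent⇔ : ∀ {u u′ v v′} → Adjacent (G₁ □ G₂) (combine u u′) (combine v v′) ⇔
                ((u ≡ v × Adjacent G₂ u′ v′) ⊎ (Adjacent G₁ u v × u′ ≡ v′))
  □-adjacent⇔ {u} {u′} {v} {v′} = mk⇔ split join
    where
    split : Adjacent (G₁ □ G₂) (combine u u′) (combine v v′) →
            (u ≡ v × Adjacent G₂ u′ v′) ⊎ (Adjacent G₁ u v × u′ ≡ v′)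
    split adj with T-∨ .to (T-≡ .from (trans (sym (□-combine u u′ v v′)) adj))
    ... | inj₁ vertical   with u≡v , u′∼v′ ← T-∧ .to vertical   = inj₁ (toWitness u≡v , T-≡ .to u′∼v′)
    ... | inj₂ horizontal with u∼v , u′≡v′ ← T-∧ .to horizontal = inj₂ (T-≡ .to u∼v , toWitness u′≡v′)

    join : (u ≡ v × Adjacent G₂ u′ v′) ⊎ (Adjacent G₁ u v × u′ ≡ v′) →
           Adjacent (G₁ □ G₂) (combine u u′) (combine v v′)
    join edge = trans (□-combine u u′ v v′) (T-≡ .to (T-∨ .from (T-edge edge)))
      where
      T-edge : (u ≡ v × Adjacent G₂ u′ v′) ⊎ (Adjacent G₁ u v × u′ ≡ v′) →
               T (⌊ u ≟ v ⌋ ∧ G₂ u′ v′) ⊎ T (G₁ u v ∧ ⌊ u′ ≟ v′ ⌋)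
      T-edge (inj₁ (u≡v , u′∼v′)) = inj₁ (T-∧ .from (fromWitness u≡v , T-≡ .from u′∼v′))
      T-edge (inj₂ (u∼v , u′≡v′)) = inj₂ (T-∧ .from (T-≡ .from u∼v , fromWitness u′≡v′))

  □-common-neighbour⇒adjacent : IsSimple G₁ → IsSimple G₂ → ∀ {u u′ v v′ z} → u ≢ v → u′ ≢ v′ →
    Adjacent (G₁ □ G₂) (combine u u′) z → Adjacent (G₁ □ G₂) (combine v v′) z →
    Adjacent G₁ u v × Adjacent G₂ u′ v′
  □-common-neighbour⇒adjacent simple₁ simple₂ {z = z} u≢v u′≢v′ x∼z y∼z
    with _ , _ , refl ← combine-surjective {n₁} {n₂} z
    with □-adjacent⇔ .to x∼z | □-adjacent⇔ .to y∼z
  ... | inj₁ (refl , _)     | inj₁ (refl , _)       = contradiction refl u≢v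
  ... | inj₁ (refl , u′∼v′) | inj₂ (v∼u , refl)     = Adjacent-sym simple₁ v∼u , u′∼v′
  ... | inj₂ (u∼v , refl)   | inj₁ (refl , v′∼u′)   = u∼v , Adjacent-sym simple₂ v′∼u′
  ... | inj₂ (_ , refl)     | inj₂ (_ , refl)       = contradiction refl u′≢v′

  □-non-adjacent : ∀ {u u′ v v′} → u ≢ v → u′ ≢ v′ → ¬ Adjacent (G₁ □ G₂) (combine u u′) (combine v v′)
  □-non-adjacent u≢v u′≢v′ x∼y with □-adjacent⇔ .to x∼y
  ... | inj₁ (u≡v , _)   = u≢v u≡v
  ... | inj₂ (_ , u′≡v′) = u′≢v′ u′≡v′

  □-complete-factors : IsSimple G₁ → IsSimple G₂ →
    (∀ x y → x ≢ y → ¬ Adjacent (G₁ □ G₂) x y → common (G₁ □ G₂) x y ≡ suc m) →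
    {a b : Fin n₁} → a ≢ b → {a′ b′ : Fin n₂} → a′ ≢ b′ → IsComplete G₁ × IsComplete G₂
  □-complete-factors simple₁ simple₂ μ>0 a≢b a′≢b′ =
    (λ u v u≢v → proj₁ (diagonal u≢v a′≢b′)) , (λ u′ v′ u′≢v′ → proj₂ (diagonal a≢b u′≢v′))
    where
    diagonal : ∀ {u u′ v v′} → u ≢ v → u′ ≢ v′ → Adjacent G₁ u v × Adjacent G₂ u′ v′
    diagonal {u} {u′} {v} {v′} u≢v u′≢v′
      with z , z∈ ← ∣p∣≡suc⇒Nonempty
                      (μ>0 _ _ (u≢v ∘ combine-injectiveˡ u u′ v v′) (□-non-adjacent u≢v u′≢v′))
      with x∼z , y∼z ← common-neighbour⁻ {G = G₁ □ G₂} z∈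
      = □-common-neighbour⇒adjacent simple₁ simple₂ u≢v u′≢v′ x∼z y∼z

  □-K₄ˡ : IsComplete G₁ → (4≤n₁ : 4 ≤ n₁) → (a : Fin n₂) →
          IsK₄ (G₁ □ G₂) (λ i → combine (inject≤ i 4≤n₁) a)
  □-K₄ˡ complete 4≤n₁ a i j i≢j = □-adjacent⇔ .from (inj₂ (complete⇒K₄ complete 4≤n₁ i j i≢j , refl))

  □-K₄ʳ : IsComplete G₂ → (4≤n₂ : 4 ≤ n₂) → (a : Fin n₁) →
          IsK₄ (G₁ □ G₂) (λ i → combine a (inject≤ i 4≤n₂))
  □-K₄ʳ complete 4≤n₂ a i j i≢j = □-adjacent⇔ .from (inj₁ (refl , complete⇒K₄ complete 4≤n₂ i j i≢j))

theorem11 : ∀ {n₁ n₂} (G₁ : Graph n₁) (G₂ : Graph n₂) (d₁ k₁ d₂ k₂ : ℕ) →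
    IsRCA G₁ n₁ d₁ k₁ → IsRCA G₂ n₂ d₂ k₂ → ¬ IsSRG (G₁ □ G₂) 99 14 1 2
theorem11 G₁ G₂ _ _ _ _ rca₁ rca₂ (simple , n₁n₂≡99 , _ , λ≡1 , μ≡2)
  with a₁ , _ , a₁≢b₁ ← two-distinct (IsRCA⇒2≤n rca₁)
  with a₂ , _ , a₂≢b₂ ← two-distinct (IsRCA⇒2≤n rca₂)
  with complete₁ , complete₂ ← □-complete-factors (proj₁ rca₁) (proj₁ rca₂) μ≡2 a₁≢b₁ a₂≢b₂
  with 9<m*n⇒4≤m⊎4≤n (subst (9 <_) (sym n₁n₂≡99) (from-yes (10 ≤? 99)))
... | inj₁ 4≤n₁ = λ≤1⇒¬K₄ simple (λ x y → ≤-reflexive ∘ λ≡1 x y) (□-K₄ˡ {G₂ = G₂} complete₁ 4≤n₁ a₂)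
... | inj₂ 4≤n₂ = λ≤1⇒¬K₄ simple (λ x y → ≤-reflexive ∘ λ≡1 x y) (□-K₄ʳ {G₁ = G₁} complete₂ 4≤n₂ a₁)
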